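{- There exist a finite ground set $V$, a nonnegative ordered-submodular function $f$ on finite sequences of elements of $V$, an integer $k \ge 1$, and an execution of the greedy algorithm (with some tie-breaking) whose output $A_k$ satisfies $$f(A_k) = \tfrac12\,\mathrm{OPT}(k) \quad\text{with}\quad \mathrm{OPT}(k) = \max\{f(S) : S \text{ a sequence of } k \text{ elements of } V\} > 0.$$ In particular the factor $\tfrac12$ in the approximation guarantee of the greedy algorithm for nonnegative ordered-submodular maximization cannot be improved.
   Context: For sequences $A, B$, $A\|B$ denotes concatenation and $A\|s$ denotes $A$ with element $s$ appended; $\emptyset$ is the empty sequence. A function $f$ on finite sequences of elements of $V$ is ordered-submodular if for all sequences $A$, $B$ and all elements $s, \bar s \in V$: $f(A\|s) - f(A) \ge f(A\|s\|B) - f(A\|\bar s\|B)$. The greedy algorithm: $A_0 = \emptyset$; for $\ell = 1,\dots,k$, $A_\ell = A_{\ell-1}\|a$ where $a \in V$ maximizes $f(A_{\ell-1}\|a)$, ties broken arbitrarily. -}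

module Defs where

open import Data.Nat using (ℕ; zero; suc)
open import Data.List using (List; []; _∷_; _++_; [_]; length)
open import Data.Rational using (ℚ; 0ℚ; _≤_; _-_)
open import Relation.Binary.PropositionalEquality using (_≡_)
open import Data.Product using (Σ; _×_)

SeqFun : Set → Set
SeqFun V = List V → ℚ

Nonneg : {V : Set} → SeqFun V → Set
Nonneg {V} f = (A : List V) → 0ℚ ≤ f A

OrderedSubmodular : {V : Set} → SeqFun V → Set
OrderedSubmodular {V} f =
  (A B : List V) (s s̄ : V) →
  f ((A ++ [ s ]) ++ B) - f ((A ++ [ s̄ ]) ++ B) ≤ f (A ++ [ s ]) - f A

data GreedyRun {V : Set} (f : SeqFun V) : ℕ → List V → Set where
  start : GreedyRun f zero []
  step  : ∀ {ℓ A} → GreedyRun f ℓ A → (a : V) →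
          ((b : V) → f (A ++ [ b ]) ≤ f (A ++ [ a ])) →
          GreedyRun f (suc ℓ) (A ++ [ a ])

IsOPT : {V : Set} → SeqFun V → ℕ → ℚ → Set
IsOPT {V} f k opt =
  (Σ (List V) λ S → (length S ≡ k) × (f S ≡ opt)) ×
  ((S : List V) → length S ≡ k → f S ≤ opt)

{-# OPTIONS --safe #-}
module Submission where

-- Over V = {a, b} let f credit the first element with 1 and, only when that element is b, credit any
-- further elements with 1 more.  Both singletons are worth 1, so the greedy algorithm may break the tie
-- towards a and is stuck at 1, while b b is worth 2.  Ordered-submodularity holds because a value depends
-- only on the first element and on whether there is a second one, and nonempty sequences are worth 1 or 2.

open import Defs
open import Data.Nat using (ℕ; _≥_; s≤s; z≤n)
open import Data.Fin using (Fin; zero; suc)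
open import Data.List using (List; []; _∷_; _++_; [_])
open import Data.Product using (Σ; _×_; ∃-syntax; _,_)
open import Data.Rational using (ℚ; 0ℚ; 1ℚ; ½; -_; _*_; _+_; _-_; _≤_; _<_; _≤?_; _<?_)
open import Data.Rational.Properties using (≤-refl; +-inverseʳ; +-monoˡ-≤; module ≤-Reasoning)
open import Relation.Nullary.Decidable using (True; toWitness)
open import Relation.Binary.PropositionalEquality using (_≡_; refl; sym)

≤-by-computation : ∀ {p q} → True (p ≤? q) → p ≤ q
≤-by-computation = toWitness

<-by-computation : ∀ {p q} → True (p <? q) → p < q
<-by-computation = toWitness

p-p≤q-r : ∀ p {q r} → r ≤ q → p - p ≤ q - r
p-p≤q-r p {q} {r} r≤q = begin
  p - p  ≡⟨ +-inverseʳ p ⟩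
  0ℚ     ≡⟨ sym (+-inverseʳ r) ⟩
  r - r  ≤⟨ +-monoˡ-≤ (- r) r≤q ⟩
  q - r  ∎
  where open ≤-Reasoning

orderedSubmodular-if-blind-to-last : ∀ {V} (f : SeqFun V) (A B : List V) (s s̄ : V) →
  f A ≤ f (A ++ [ s ]) →
  f ((A ++ [ s ]) ++ B) ≡ f ((A ++ [ s̄ ]) ++ B) →
  f ((A ++ [ s ]) ++ B) - f ((A ++ [ s̄ ]) ++ B) ≤ f (A ++ [ s ]) - f A
orderedSubmodular-if-blind-to-last f A B s s̄ mono blind rewrite blind =
  p-p≤q-r (f ((A ++ [ s̄ ]) ++ B)) mono

pattern a = zero
pattern b = suc zero

2ℚ : ℚ
2ℚ = 1ℚ + 1ℚ

trap : SeqFun (Fin 2)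
trap []          = 0ℚ
trap (a ∷ _)     = 1ℚ
trap (b ∷ [])    = 1ℚ
trap (b ∷ _ ∷ _) = 2ℚ

trap-nonneg : Nonneg trap
trap-nonneg []          = ≤-by-computation _
trap-nonneg (a ∷ _)     = ≤-by-computation _
trap-nonneg (b ∷ [])    = ≤-by-computation _
trap-nonneg (b ∷ _ ∷ _) = ≤-by-computation _

trap-≤-2 : (S : List (Fin 2)) → trap S ≤ 2ℚ
trap-≤-2 []          = ≤-by-computation _
trap-≤-2 (a ∷ _)     = ≤-by-computation _
trap-≤-2 (b ∷ [])    = ≤-by-computation _
trap-≤-2 (b ∷ _ ∷ _) = ≤-by-computation _

trap-mono-∷ʳ : (A : List (Fin 2)) (s : Fin 2) → trap A ≤ trap (A ++ [ s ])
trap-mono-∷ʳ []          a = ≤-by-computation _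
trap-mono-∷ʳ []          b = ≤-by-computation _
trap-mono-∷ʳ (a ∷ _)     s = ≤-refl
trap-mono-∷ʳ (b ∷ [])    s = ≤-by-computation _
trap-mono-∷ʳ (b ∷ _ ∷ _) s = ≤-refl

trap-blind-after-head : (x : Fin 2) (A B : List (Fin 2)) (s s̄ : Fin 2) →
  trap (((x ∷ A) ++ [ s ]) ++ B) ≡ trap (((x ∷ A) ++ [ s̄ ]) ++ B)
trap-blind-after-head a _       _ _ _ = refl
trap-blind-after-head b []      _ _ _ = refl
trap-blind-after-head b (_ ∷ _) _ _ _ = refl

trap-orderedSubmodular : OrderedSubmodular trap
trap-orderedSubmodular []      []      a a = ≤-by-computation _
trap-orderedSubmodular []      []      a b = ≤-by-computation _
trap-orderedSubmodular []      []      b a = ≤-by-computation _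
trap-orderedSubmodular []      []      b b = ≤-by-computation _
trap-orderedSubmodular []      (_ ∷ _) a a = ≤-by-computation _
trap-orderedSubmodular []      (_ ∷ _) a b = ≤-by-computation _
trap-orderedSubmodular []      (_ ∷ _) b a = ≤-by-computation _
trap-orderedSubmodular []      (_ ∷ _) b b = ≤-by-computation _
trap-orderedSubmodular (x ∷ A) B       s s̄ =
  orderedSubmodular-if-blind-to-last trap (x ∷ A) B s s̄
    (trap-mono-∷ʳ (x ∷ A) s) (trap-blind-after-head x A B s s̄)

trap-greedy-aa : GreedyRun trap 2 (a ∷ a ∷ [])
trap-greedy-aa = step (step start a a-ties) a (λ _ → ≤-refl)
  where
  a-ties : (x : Fin 2) → trap [ x ] ≤ trap [ a ]
  a-ties a = ≤-refl
  a-ties b = ≤-refl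

trap-OPT₂ : IsOPT trap 2 2ℚ
trap-OPT₂ = ((b ∷ b ∷ []) , refl , refl) , λ S _ → trap-≤-2 S

theorem2 : ∃[ n ] Σ (SeqFun (Fin n)) λ f → Nonneg f × OrderedSubmodular f ×
    Σ ℕ λ k → k ≥ 1 × Σ (List (Fin n)) λ A → GreedyRun f k A ×
    Σ ℚ λ opt → IsOPT f k opt × 0ℚ < opt × f A ≡ ½ * opt
theorem2 =
  2 , trap , trap-nonneg , trap-orderedSubmodular ,
  2 , s≤s z≤n , (a ∷ a ∷ []) , trap-greedy-aa ,
  2ℚ , trap-OPT₂ , <-by-computation _ , refl
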